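{- Let $t$ be a positive integer and let $G$ be a graph with maximum degree $d$ and $E$ edges, where $E\geq 4dt$. Then the number of $t$-matchings in $G$ is at least $\frac{E^t}{2^t t!}$. Moreover, if $E\geq 4dt^2$, then the number of $t$-matchings in $G$ is at least $\frac{1}{2}\frac{E^t}{t!}$.
   Context: A $t$-matching is an unordered set of $t$ pairwise vertex-disjoint edges. -}

module Defs where

open import Data.Bool using (Bool; true; false; _∧_; not; T)
open import Data.Nat using (ℕ; zero; suc; _⊔_; _<ᵇ_)
open import Data.Fin using (Fin; toℕ; _≟_)
open import Data.List using (List; []; _∷_; _++_; map; length; filterᵇ; concatMap; foldr; allFin)
open import Data.Product using (_×_; _,_)
open import Relation.Nullary.Decidable using (⌊_⌋)
open import Relation.Binary.PropositionalEquality using (_≡_)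

record Graph (n : ℕ) : Set where
  field
    adj   : Fin n → Fin n → Bool
    sym   : ∀ u v → adj u v ≡ adj v u
    irrefl : ∀ v → adj v v ≡ false
open Graph public

Edge : ℕ → Set
Edge n = Fin n × Fin n

degree : ∀ {n} → Graph n → Fin n → ℕ
degree {n} G v = length (filterᵇ (adj G v) (allFin n))

maxDegree : ∀ {n} → Graph n → ℕ
maxDegree {n} G = foldr (λ v m → degree G v ⊔ m) 0 (allFin n)

-- the edge list: each edge {i,j} listed exactly once as (i , j) with i < j
edges : ∀ {n} → Graph n → List (Edge n)
edges {n} G = concatMap (λ i → map (λ j → (i , j))
                 (filterᵇ (λ j → (toℕ i <ᵇ toℕ j) ∧ adj G i j) (allFin n)))
              (allFin n)

numEdges : ∀ {n} → Graph n → ℕ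
numEdges G = length (edges G)

-- all k-element sublists (k-subsets, as the list has no duplicates)
choose : ∀ {A : Set} → ℕ → List A → List (List A)
choose zero    _        = [] ∷ []
choose (suc k) []       = []
choose (suc k) (x ∷ xs) = map (x ∷_) (choose k xs) ++ choose (suc k) xs

neq : ∀ {n} → Fin n → Fin n → Bool
neq a b = not ⌊ a ≟ b ⌋

disjoint : ∀ {n} → Edge n → Edge n → Bool
disjoint (a , b) (c , d) = neq a c ∧ neq a d ∧ neq b c ∧ neq b d

pairwiseDisjoint : ∀ {n} → List (Edge n) → Bool
pairwiseDisjoint []       = true
pairwiseDisjoint (e ∷ es) = foldr (λ f b → disjoint e f ∧ b) true es ∧ pairwiseDisjoint es

numMatchings : ∀ {n} → ℕ → Graph n → ℕ
numMatchings t G = length (filterᵇ pairwiseDisjoint (choose t (edges G)))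

-- Every edge meets at most 2d edges, itself included.  Choosing a matching
-- edge by edge, after j choices at least E − 2dj edges remain available, and
-- double counting the ordered choices gives t! · #matchings ≥ (E − 2dt)^t.
-- If 4dt ≤ E then E ≤ 2(E − 2dt), giving the first bound; if 4dt² ≤ E, the
-- mean value inequality x^t − y^t ≤ t(x − y)x^(t−1) gives E^t ≤ 2(E − 2dt)^t,
-- giving the second.

module Submission where

open import Data.Bool using (Bool; true; false; _∧_; not; T)
open import Data.Bool.ListAction using (all)
open import Data.Bool.Properties using (T?; ∧-comm; ∧-zeroʳ)
open import Data.Empty using (⊥; ⊥-elim)
open import Data.Fin using (Fin; zero; suc; toℕ; _≟_)
open import Data.List using (List; []; _∷_; _++_; map; length; filterᵇ; concatMap; foldr; allFin; tabulate)
open import Data.List.Membership.Propositional using (_∈_)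
open import Data.List.Membership.Propositional.Properties using (∈-allFin)
open import Data.List.Properties using (filter-++; filter-reject; length-++; length-filter; length-map; map-tabulate)
open import Data.List.Relation.Unary.Any using (here; there)
open import Data.Nat using (ℕ; zero; suc; _+_; _*_; _∸_; _^_; _!; _⊔_; _<ᵇ_; _≤_; z≤n; s≤s)
open import Data.Nat.Properties
  using ( +-assoc; +-comm; +-identityʳ; +-suc; +-mono-≤; +-monoˡ-≤; +-monoʳ-≤; +-cancelʳ-≤
        ; *-assoc; *-comm; *-identityˡ; *-identityʳ; *-zeroʳ; *-distribˡ-+; *-mono-≤; *-monoˡ-≤; *-monoʳ-≤
        ; ^-monoˡ-≤; ≤-refl; ≤-trans; ≤-reflexive; <-asym; <ᵇ⇒<; m≤m+n; m≤m⊔n; m≤n⇒m≤o⊔n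
        ; m∸n≤m; ∸-+-assoc; ∸-monoˡ-≤; ∸-monoʳ-≤; m≤n+m∸n; m+n∸n≡m; m∸n+n≡m; m+n≤o⇒m≤o∸n
        ; +-commutativeSemigroup; *-commutativeSemigroup; module ≤-Reasoning )
open import Data.Nat.Tactic.RingSolver using (solve-∀)
open import Data.Product using (_×_; _,_)
open import Defs hiding (sym)
open import Function using (id; _∘_)
open import Relation.Binary.PropositionalEquality
  using (_≡_; refl; sym; trans; cong; cong₂; subst; module ≡-Reasoning)
open import Relation.Nullary.Decidable using (⌊_⌋; yes; no)

open import Algebra.Properties.CommutativeSemigroup +-commutativeSemigroup
  using () renaming (interchange to +-interchange)
open import Algebra.Properties.CommutativeSemigroup *-commutativeSemigroup
  using () renaming (interchange to *-interchange)

private variable A B : Set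

∑ : List A → (A → ℕ) → ℕ
∑ []       f = 0
∑ (x ∷ xs) f = f x + ∑ xs f

syntax ∑ xs (λ x → e) = ∑[ x ∈ xs ] e

𝟙 : Bool → ℕ
𝟙 true  = 1
𝟙 false = 0

∑-cong : ∀ {f g : A → ℕ} → (∀ x → f x ≡ g x) → ∀ xs → ∑ xs f ≡ ∑ xs g
∑-cong f≗g []       = refl
∑-cong f≗g (x ∷ xs) = cong₂ _+_ (f≗g x) (∑-cong f≗g xs)

∑-mono-≤ : ∀ {f g : A → ℕ} → (∀ x → f x ≤ g x) → ∀ xs → ∑ xs f ≤ ∑ xs g
∑-mono-≤ f≤g []       = z≤n
∑-mono-≤ f≤g (x ∷ xs) = +-mono-≤ (f≤g x) (∑-mono-≤ f≤g xs)

∑-distrib-+ : ∀ (f g : A → ℕ) xs → ∑[ x ∈ xs ] (f x + g x) ≡ ∑ xs f + ∑ xs g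
∑-distrib-+ f g []       = refl
∑-distrib-+ f g (x ∷ xs) =
  trans (cong (f x + g x +_) (∑-distrib-+ f g xs)) (+-interchange (f x) (g x) _ _)

∑-distribˡ-* : ∀ c (f : A → ℕ) xs → ∑[ x ∈ xs ] (c * f x) ≡ c * ∑ xs f
∑-distribˡ-* c f []       = sym (*-zeroʳ c)
∑-distribˡ-* c f (x ∷ xs) =
  trans (cong (c * f x +_) (∑-distribˡ-* c f xs)) (sym (*-distribˡ-+ c (f x) (∑ xs f)))

∑-const : ∀ c (xs : List A) → ∑[ _ ∈ xs ] c ≡ length xs * c
∑-const c []       = refl
∑-const c (x ∷ xs) = cong (c +_) (∑-const c xs)

∑-++ : ∀ (f : A → ℕ) xs ys → ∑ (xs ++ ys) f ≡ ∑ xs f + ∑ ys f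
∑-++ f []       ys = refl
∑-++ f (x ∷ xs) ys = trans (cong (f x +_) (∑-++ f xs ys)) (sym (+-assoc (f x) _ _))

∑-map : ∀ (f : B → ℕ) (g : A → B) xs → ∑ (map g xs) f ≡ ∑[ x ∈ xs ] f (g x)
∑-map f g []       = refl
∑-map f g (x ∷ xs) = cong (f (g x) +_) (∑-map f g xs)

∑-concatMap : ∀ (f : B → ℕ) (g : A → List B) xs →
              ∑ (concatMap g xs) f ≡ ∑[ x ∈ xs ] ∑ (g x) f
∑-concatMap f g []       = refl
∑-concatMap f g (x ∷ xs) = trans (∑-++ f (g x) _) (cong (∑ (g x) f +_) (∑-concatMap f g xs))

∑-filterᵇ : ∀ (p : A → Bool) (f : A → ℕ) xs → ∑ (filterᵇ p xs) f ≡ ∑[ x ∈ xs ] (𝟙 (p x) * f x)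
∑-filterᵇ p f []       = refl
∑-filterᵇ p f (x ∷ xs) with p x
... | true  = cong₂ _+_ (sym (+-identityʳ (f x))) (∑-filterᵇ p f xs)
... | false = ∑-filterᵇ p f xs

length-filterᵇ≡∑𝟙 : ∀ (p : A → Bool) xs → length (filterᵇ p xs) ≡ ∑[ x ∈ xs ] 𝟙 (p x)
length-filterᵇ≡∑𝟙 p []       = refl
length-filterᵇ≡∑𝟙 p (x ∷ xs) with p x
... | true  = cong suc (length-filterᵇ≡∑𝟙 p xs)
... | false = length-filterᵇ≡∑𝟙 p xs

filterᵇ-cong : ∀ {p q : A → Bool} → (∀ x → p x ≡ q x) → ∀ xs → filterᵇ p xs ≡ filterᵇ q xs
filterᵇ-cong p≗q [] = refl
filterᵇ-cong {p = p} {q = q} p≗q (x ∷ xs) with p x | q x | p≗q x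
... | true  | .true  | refl = cong (x ∷_) (filterᵇ-cong p≗q xs)
... | false | .false | refl = filterᵇ-cong p≗q xs

filterᵇ-false : ∀ xs → filterᵇ (λ (_ : A) → false) xs ≡ []
filterᵇ-false []       = refl
filterᵇ-false (x ∷ xs) = filterᵇ-false xs

filterᵇ-∧ : ∀ (p q : A → Bool) xs → filterᵇ (λ x → p x ∧ q x) xs ≡ filterᵇ q (filterᵇ p xs)
filterᵇ-∧ p q []       = refl
filterᵇ-∧ p q (x ∷ xs) with p x
... | false = filterᵇ-∧ p q xs
... | true with q x
...   | true  = cong (x ∷_) (filterᵇ-∧ p q xs)
...   | false = filterᵇ-∧ p q xs

filterᵇ-comm : ∀ (p q : A → Bool) xs → filterᵇ p (filterᵇ q xs) ≡ filterᵇ q (filterᵇ p xs)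
filterᵇ-comm p q xs = begin
  filterᵇ p (filterᵇ q xs)       ≡⟨ filterᵇ-∧ q p xs ⟨
  filterᵇ (λ x → q x ∧ p x) xs  ≡⟨ filterᵇ-cong (λ x → ∧-comm (q x) (p x)) xs ⟩
  filterᵇ (λ x → p x ∧ q x) xs  ≡⟨ filterᵇ-∧ p q xs ⟩
  filterᵇ q (filterᵇ p xs)       ∎
  where open ≡-Reasoning

filterᵇ-map : ∀ (p : B → Bool) (f : A → B) xs →
              filterᵇ p (map f xs) ≡ map f (filterᵇ (p ∘ f) xs)
filterᵇ-map p f []       = refl
filterᵇ-map p f (x ∷ xs) with p (f x)
... | true  = cong (f x ∷_) (filterᵇ-map p f xs)
... | false = filterᵇ-map p f xs

length-filterᵇ-partition : ∀ (p : A → Bool) xs →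
  length xs ≡ length (filterᵇ p xs) + length (filterᵇ (not ∘ p) xs)
length-filterᵇ-partition p []       = refl
length-filterᵇ-partition p (x ∷ xs) with p x
... | true  = cong suc (length-filterᵇ-partition p xs)
... | false = trans (cong suc (length-filterᵇ-partition p xs)) (sym (+-suc _ _))

filterᵇ-all-choose : ∀ (p : A → Bool) k xs → filterᵇ (all p) (choose k xs) ≡ choose k (filterᵇ p xs)
filterᵇ-all-choose p zero    xs       = refl
filterᵇ-all-choose p (suc k) []       = refl
filterᵇ-all-choose p (suc k) (y ∷ ys) = begin
  filterᵇ (all p) (map (y ∷_) (choose k ys) ++ choose (suc k) ys)
    ≡⟨ filter-++ (T? ∘ all p) (map (y ∷_) (choose k ys)) (choose (suc k) ys) ⟩
  filterᵇ (all p) (map (y ∷_) (choose k ys)) ++ filterᵇ (all p) (choose (suc k) ys)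
    ≡⟨ cong₂ _++_ (filterᵇ-map (all p) (y ∷_) (choose k ys)) (filterᵇ-all-choose p (suc k) ys) ⟩
  map (y ∷_) (filterᵇ (λ zs → p y ∧ all p zs) (choose k ys)) ++ choose (suc k) (filterᵇ p ys)
    ≡⟨ head-case (p y) refl ⟩
  choose (suc k) (filterᵇ p (y ∷ ys)) ∎
  where
  open ≡-Reasoning
  head-case : ∀ b → p y ≡ b →
    map (y ∷_) (filterᵇ (λ zs → p y ∧ all p zs) (choose k ys)) ++ choose (suc k) (filterᵇ p ys)
      ≡ choose (suc k) (filterᵇ p (y ∷ ys))
  head-case true  py rewrite py = cong₂ _++_ (cong (map (y ∷_)) (filterᵇ-all-choose p k ys)) refl
  head-case false py rewrite py = cong₂ _++_ (cong (map (y ∷_)) (filterᵇ-false (choose k ys))) refl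

pairwiseᵇ : (A → A → Bool) → List A → Bool
pairwiseᵇ R []       = true
pairwiseᵇ R (x ∷ xs) = all (R x) xs ∧ pairwiseᵇ R xs

-- Cliques of a compatibility relation R are lists of pairwise R-related
-- elements; the t-matchings of a graph are the t-cliques of `disjoint`.
module Cliques (R : A → A → Bool) where

  compatible : A → List A → List A
  compatible x = filterᵇ (R x)

  -- For irreflexive R this counts x itself whenever x ∈ xs.
  conflicts : A → List A → ℕ
  conflicts x xs = length (filterᵇ (not ∘ R x) xs)

  numCliques : ℕ → List A → ℕ
  numCliques k xs = length (filterᵇ (pairwiseᵇ R) (choose k xs))

  numCliques-∷ : ∀ k x xs →
    numCliques (suc k) (x ∷ xs) ≡ numCliques k (compatible x xs) + numCliques (suc k) xs
  numCliques-∷ k x xs = begin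
    length (filterᵇ P (map (x ∷_) Cₖ ++ Cₖ₊₁))
      ≡⟨ cong length (filter-++ (T? ∘ P) (map (x ∷_) Cₖ) Cₖ₊₁) ⟩
    length (filterᵇ P (map (x ∷_) Cₖ) ++ filterᵇ P Cₖ₊₁)
      ≡⟨ length-++ (filterᵇ P (map (x ∷_) Cₖ)) ⟩
    length (filterᵇ P (map (x ∷_) Cₖ)) + numCliques (suc k) xs
      ≡⟨ cong (λ ys → length ys + numCliques (suc k) xs) (filterᵇ-map P (x ∷_) Cₖ) ⟩
    length (map (x ∷_) (filterᵇ (λ ys → all (R x) ys ∧ P ys) Cₖ)) + numCliques (suc k) xs
      ≡⟨ cong (_+ numCliques (suc k) xs) (length-map (x ∷_) (filterᵇ (λ ys → all (R x) ys ∧ P ys) Cₖ)) ⟩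
    length (filterᵇ (λ ys → all (R x) ys ∧ P ys) Cₖ) + numCliques (suc k) xs
      ≡⟨ cong (λ ys → length ys + numCliques (suc k) xs) (filterᵇ-∧ (all (R x)) P Cₖ) ⟩
    length (filterᵇ P (filterᵇ (all (R x)) Cₖ)) + numCliques (suc k) xs
      ≡⟨ cong (λ ys → length (filterᵇ P ys) + numCliques (suc k) xs) (filterᵇ-all-choose (R x) k xs) ⟩
    numCliques k (compatible x xs) + numCliques (suc k) xs ∎
    where
    open ≡-Reasoning
    P : List A → Bool
    P = pairwiseᵇ R
    Cₖ Cₖ₊₁ : List (List A)
    Cₖ   = choose k xs
    Cₖ₊₁ = choose (suc k) xs

  numCliques-1 : ∀ xs → numCliques 1 xs ≡ length xs
  numCliques-1 []       = refl
  numCliques-1 (x ∷ xs) = trans (numCliques-∷ 0 x xs) (cong suc (numCliques-1 xs))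

  conflicts-compatible : ∀ x y xs → conflicts y (compatible x xs) ≤ conflicts y xs
  conflicts-compatible x y xs = begin
    length (filterᵇ (not ∘ R y) (filterᵇ (R x) xs))
      ≡⟨ cong length (filterᵇ-comm (not ∘ R y) (R x) xs) ⟩
    length (filterᵇ (R x) (filterᵇ (not ∘ R y) xs))
      ≤⟨ length-filter (T? ∘ R x) (filterᵇ (not ∘ R y) xs) ⟩
    conflicts y xs ∎
    where open ≤-Reasoning

  length-compatible : ∀ x xs → length (compatible x xs) ≡ length xs ∸ conflicts x xs
  length-compatible x xs = begin
    length (compatible x xs)
      ≡⟨ m+n∸n≡m _ (conflicts x xs) ⟨
    length (compatible x xs) + conflicts x xs ∸ conflicts x xs
      ≡⟨ cong (_∸ conflicts x xs) (length-filterᵇ-partition (R x) xs) ⟨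
    length xs ∸ conflicts x xs ∎
    where open ≡-Reasoning

  module _ (R-sym : ∀ x y → R x y ≡ R y x) (R-irrefl : ∀ x → R x x ≡ false) where

    numCliques-compatible-∷ : ∀ k x y ys →
      numCliques (suc k) (compatible x (y ∷ ys))
        ≡ numCliques (suc k) (compatible x ys) + 𝟙 (R y x) * numCliques k (compatible x (compatible y ys))
    numCliques-compatible-∷ k x y ys rewrite R-sym y x with R x y
    ... | false = sym (+-identityʳ _)
    ... | true  = begin
      numCliques (suc k) (y ∷ compatible x ys)
        ≡⟨ numCliques-∷ k y (compatible x ys) ⟩
      numCliques k (compatible y (compatible x ys)) + numCliques (suc k) (compatible x ys)
        ≡⟨ +-comm _ (numCliques (suc k) (compatible x ys)) ⟩
      numCliques (suc k) (compatible x ys) + numCliques k (compatible y (compatible x ys))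
        ≡⟨ cong (λ zs → numCliques (suc k) (compatible x ys) + numCliques k zs) (filterᵇ-comm (R y) (R x) ys) ⟩
      numCliques (suc k) (compatible x ys) + numCliques k (compatible x (compatible y ys))
        ≡⟨ cong (numCliques (suc k) (compatible x ys) +_) (sym (+-identityʳ _)) ⟩
      numCliques (suc k) (compatible x ys) + 1 * numCliques k (compatible x (compatible y ys)) ∎
      where open ≡-Reasoning

    -- Double counting: a (k+1)-clique with a marked element x is the same as
    -- x together with a k-clique among the elements compatible with x.
    suc-*-numCliques : ∀ k xs → suc k * numCliques (suc k) xs ≡ ∑[ x ∈ xs ] numCliques k (compatible x xs)
    suc-*-numCliques zero    xs       = begin
      numCliques 1 xs + 0  ≡⟨ +-identityʳ _ ⟩
      numCliques 1 xs      ≡⟨ numCliques-1 xs ⟩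
      length xs            ≡⟨ *-identityʳ _ ⟨
      length xs * 1        ≡⟨ ∑-const 1 xs ⟨
      ∑[ _ ∈ xs ] 1        ∎
      where open ≡-Reasoning
    suc-*-numCliques (suc k) []       = *-zeroʳ (2 + k)
    suc-*-numCliques (suc k) (y ∷ ys) = begin
      (2 + k) * N₂ (y ∷ ys)
        ≡⟨ cong ((2 + k) *_) (numCliques-∷ (suc k) y ys) ⟩
      (2 + k) * (N₁ Cy + N₂ ys)
        ≡⟨ regroup (N₁ Cy) (N₂ ys) ⟩
      N₁ Cy + ((2 + k) * N₂ ys + (1 + k) * N₁ Cy)
        ≡⟨ cong₂ (λ s t → N₁ Cy + (s + t)) (suc-*-numCliques (suc k) ys) (suc-*-numCliques k Cy) ⟩
      N₁ Cy + (∑[ x ∈ ys ] N₁ (compatible x ys) + ∑[ x ∈ Cy ] N₀ (compatible x Cy))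
        ≡⟨ cong (λ s → N₁ Cy + (∑[ x ∈ ys ] N₁ (compatible x ys) + s)) (∑-filterᵇ (R y) _ ys) ⟩
      N₁ Cy + (∑[ x ∈ ys ] N₁ (compatible x ys) + ∑[ x ∈ ys ] (𝟙 (R y x) * N₀ (compatible x Cy)))
        ≡⟨ cong (N₁ Cy +_) (∑-distrib-+ _ _ ys) ⟨
      N₁ Cy + ∑[ x ∈ ys ] (N₁ (compatible x ys) + 𝟙 (R y x) * N₀ (compatible x Cy))
        ≡⟨ cong₂ _+_ (cong N₁ (sym (filter-reject (T? ∘ R y) (subst T (R-irrefl y)))))
                     (∑-cong (λ x → sym (numCliques-compatible-∷ k x y ys)) ys) ⟩
      N₁ (compatible y (y ∷ ys)) + ∑[ x ∈ ys ] N₁ (compatible x (y ∷ ys)) ∎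
      where
      open ≡-Reasoning
      N₀ N₁ N₂ : List A → ℕ
      N₀ = numCliques k
      N₁ = numCliques (suc k)
      N₂ = numCliques (2 + k)
      Cy : List A
      Cy = compatible y ys
      regroup : ∀ a b → (2 + k) * (a + b) ≡ a + ((2 + k) * b + (1 + k) * a)
      regroup = solve-∀

    numCliques-lowerBound : ∀ D k xs → (∀ x → conflicts x xs ≤ D) →
      (length xs ∸ k * D) ^ k ≤ k ! * numCliques k xs
    numCliques-lowerBound D zero    xs _  = ≤-refl
    numCliques-lowerBound D (suc k) xs ≤D = begin
      (m ∸ (D + k * D)) ^ suc k
        ≤⟨ *-mono-≤ (m∸n≤m m (D + k * D)) (≤-reflexive (cong (_^ k) (sym (∸-+-assoc m D (k * D))))) ⟩
      m * (m ∸ D ∸ k * D) ^ k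
        ≡⟨ ∑-const _ xs ⟨
      ∑[ x ∈ xs ] ((m ∸ D ∸ k * D) ^ k)
        ≤⟨ ∑-mono-≤ (λ x → ^-monoˡ-≤ k (∸-monoˡ-≤ (k * D) (m∸D≤compatible x))) xs ⟩
      ∑[ x ∈ xs ] ((length (compatible x xs) ∸ k * D) ^ k)
        ≤⟨ ∑-mono-≤ (λ x → numCliques-lowerBound D k (compatible x xs) (≤D-compatible x)) xs ⟩
      ∑[ x ∈ xs ] (k ! * numCliques k (compatible x xs))
        ≡⟨ ∑-distribˡ-* (k !) _ xs ⟩
      k ! * ∑[ x ∈ xs ] numCliques k (compatible x xs)
        ≡⟨ cong (k ! *_) (suc-*-numCliques k xs) ⟨
      k ! * (suc k * numCliques (suc k) xs)
        ≡⟨ *-assoc (k !) (suc k) _ ⟨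
      k ! * suc k * numCliques (suc k) xs
        ≡⟨ cong (_* numCliques (suc k) xs) (*-comm (k !) (suc k)) ⟩
      suc k ! * numCliques (suc k) xs ∎
      where
      open ≤-Reasoning
      m : ℕ
      m = length xs
      m∸D≤compatible : ∀ x → m ∸ D ≤ length (compatible x xs)
      m∸D≤compatible x = ≤-trans (∸-monoʳ-≤ m (≤D x)) (≤-reflexive (sym (length-compatible x xs)))
      ≤D-compatible : ∀ x y → conflicts y (compatible x xs) ≤ D
      ≤D-compatible x y = ≤-trans (conflicts-compatible x y xs) (≤D y)

m≤c*n⇒m^t≤c^t*n^t : ∀ {m c n} → m ≤ c * n → ∀ t → m ^ t ≤ c ^ t * n ^ t
m≤c*n⇒m^t≤c^t*n^t m≤cn zero    = ≤-refl
m≤c*n⇒m^t≤c^t*n^t {m} {c} {n} m≤cn (suc t) =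
  ≤-trans (*-mono-≤ m≤cn (m≤c*n⇒m^t≤c^t*n^t m≤cn t)) (≤-reflexive (*-interchange c n (c ^ t) (n ^ t)))

m≤2*[m∸a] : ∀ m a → 2 * a ≤ m → m ≤ 2 * (m ∸ a)
m≤2*[m∸a] m a 2a≤m = begin
  m                  ≤⟨ m≤n+m∸n m a ⟩
  a + (m ∸ a)        ≤⟨ +-monoˡ-≤ (m ∸ a) a≤m∸a ⟩
  m ∸ a + (m ∸ a)    ≡⟨ cong (m ∸ a +_) (+-identityʳ (m ∸ a)) ⟨
  2 * (m ∸ a)        ∎
  where
  open ≤-Reasoning
  a≤m∸a : a ≤ m ∸ a
  a≤m∸a = m+n≤o⇒m≤o∸n a (subst (_≤ m) (cong (a +_) (+-identityʳ a)) 2a≤m)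

m^t≤2^t*[m∸a]^t : ∀ m a t → 2 * a ≤ m → m ^ t ≤ 2 ^ t * (m ∸ a) ^ t
m^t≤2^t*[m∸a]^t m a t 2a≤m = m≤c*n⇒m^t≤c^t*n^t {m} {2} {m ∸ a} (m≤2*[m∸a] m a 2a≤m) t

mean-value-^ : ∀ t b a → (b + a) ^ suc t ≤ b ^ suc t + suc t * a * (b + a) ^ t
mean-value-^ zero    b a = ≤-reflexive (base b a)
  where
  base : ∀ b a → (b + a) * 1 ≡ b * 1 + 1 * a * 1
  base = solve-∀
mean-value-^ (suc t) b a = begin
  (b + a) * (b + a) ^ suc t
    ≤⟨ *-monoʳ-≤ (b + a) (mean-value-^ t b a) ⟩
  (b + a) * (u + suc t * a * v)
    ≡⟨ expand b a u v t ⟩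
  b * u + a * u + suc t * a * ((b + a) * v)
    ≤⟨ +-monoˡ-≤ _ (+-monoʳ-≤ (b * u) (*-monoʳ-≤ a (^-monoˡ-≤ (suc t) (m≤m+n b a)))) ⟩
  b * u + a * ((b + a) * v) + suc t * a * ((b + a) * v)
    ≡⟨ collect b a u ((b + a) * v) t ⟩
  b * u + suc (suc t) * a * ((b + a) * v) ∎
  where
  open ≤-Reasoning
  u v : ℕ
  u = b ^ suc t
  v = (b + a) ^ t
  expand : ∀ b a u v t → (b + a) * (u + suc t * a * v) ≡ b * u + a * u + suc t * a * ((b + a) * v)
  expand = solve-∀
  collect : ∀ b a u w t → b * u + a * w + suc t * a * w ≡ b * u + suc (suc t) * a * w
  collect = solve-∀

[b+a]^[1+t]≤2*b^[1+t] : ∀ t b a → 2 * (suc t * a) ≤ b + a → (b + a) ^ suc t ≤ 2 * b ^ suc t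
[b+a]^[1+t]≤2*b^[1+t] t b a 2[1+t]a≤b+a = +-cancelʳ-≤ X X (2 * u) (begin
  X + X                      ≤⟨ +-mono-≤ (mean-value-^ t b a) (mean-value-^ t b a) ⟩
  (u + s * v) + (u + s * v)  ≡⟨ regroup u s v ⟩
  2 * u + 2 * s * v          ≤⟨ +-monoʳ-≤ (2 * u) (*-monoˡ-≤ v 2[1+t]a≤b+a) ⟩
  2 * u + X                  ∎)
  where
  open ≤-Reasoning
  X u v s : ℕ
  X = (b + a) ^ suc t
  u = b ^ suc t
  v = (b + a) ^ t
  s = suc t * a
  regroup : ∀ u s v → (u + s * v) + (u + s * v) ≡ 2 * u + 2 * s * v
  regroup = solve-∀

m^[1+t]≤2*[m∸a]^[1+t] : ∀ m a t → 2 * (suc t * a) ≤ m → m ^ suc t ≤ 2 * (m ∸ a) ^ suc t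
m^[1+t]≤2*[m∸a]^[1+t] m a t 2[1+t]a≤m =
  subst (λ k → k ^ suc t ≤ 2 * (m ∸ a) ^ suc t) m∸a+a≡m
    ([b+a]^[1+t]≤2*b^[1+t] t (m ∸ a) a (subst (2 * (suc t * a) ≤_) (sym m∸a+a≡m) 2[1+t]a≤m))
  where
  m∸a+a≡m : m ∸ a + a ≡ m
  m∸a+a≡m = m∸n+n≡m (≤-trans (m≤m+n a _) (≤-trans (m≤m+n (suc t * a) _) 2[1+t]a≤m))

∑-allFin-suc : ∀ {n} (f : Fin (suc n) → ℕ) → ∑ (allFin (suc n)) f ≡ f zero + ∑[ i ∈ allFin n ] f (suc i)
∑-allFin-suc {n} f = cong (f zero +_) (begin
  ∑ (tabulate suc) f             ≡⟨ cong (λ is → ∑ is f) (map-tabulate id suc) ⟨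
  ∑ (map suc (allFin n)) f       ≡⟨ ∑-map f suc (allFin n) ⟩
  ∑[ i ∈ allFin n ] f (suc i)    ∎)
  where open ≡-Reasoning

⌊suc≟suc⌋ : ∀ {n} (a i : Fin n) → ⌊ suc a ≟ suc i ⌋ ≡ ⌊ a ≟ i ⌋
⌊suc≟suc⌋ a i with a ≟ i
... | yes _ = refl
... | no  _ = refl

∑-δ : ∀ {n} (a : Fin n) (f : Fin n → ℕ) → ∑[ i ∈ allFin n ] (𝟙 ⌊ a ≟ i ⌋ * f i) ≡ f a
∑-δ {suc n} zero    f = begin
  ∑[ i ∈ allFin (suc n) ] (𝟙 ⌊ zero ≟ i ⌋ * f i)  ≡⟨ ∑-allFin-suc (λ i → 𝟙 ⌊ zero ≟ i ⌋ * f i) ⟩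
  1 * f zero + ∑[ i ∈ allFin n ] 0                ≡⟨ cong₂ _+_ (*-identityˡ (f zero)) ∑0≡0 ⟩
  f zero + 0                                      ≡⟨ +-identityʳ (f zero) ⟩
  f zero                                          ∎
  where
  open ≡-Reasoning
  ∑0≡0 : ∑[ i ∈ allFin n ] 0 ≡ 0
  ∑0≡0 = trans (∑-const 0 (allFin n)) (*-zeroʳ (length (allFin n)))
∑-δ {suc n} (suc a) f = begin
  ∑[ i ∈ allFin (suc n) ] (𝟙 ⌊ suc a ≟ i ⌋ * f i)        ≡⟨ ∑-allFin-suc (λ i → 𝟙 ⌊ suc a ≟ i ⌋ * f i) ⟩
  ∑[ i ∈ allFin n ] (𝟙 ⌊ suc a ≟ suc i ⌋ * f (suc i))
    ≡⟨ ∑-cong (λ i → cong (λ b → 𝟙 b * f (suc i)) (⌊suc≟suc⌋ a i)) (allFin n) ⟩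
  ∑[ i ∈ allFin n ] (𝟙 ⌊ a ≟ i ⌋ * f (suc i))            ≡⟨ ∑-δ a (f ∘ suc) ⟩
  f (suc a)                                              ∎
  where open ≡-Reasoning

≤-foldr-⊔ : ∀ (f : A → ℕ) {x xs} → x ∈ xs → f x ≤ foldr (λ y m → f y ⊔ m) 0 xs
≤-foldr-⊔ f (here refl)  = m≤m⊔n _ _
≤-foldr-⊔ f (there x∈xs) = m≤n⇒m≤o⊔n _ (≤-foldr-⊔ f x∈xs)

𝟙-∧-exclusive : ∀ p q r → (T p → T q → ⊥) → 𝟙 (p ∧ r) + 𝟙 (q ∧ r) ≤ 𝟙 r
𝟙-∧-exclusive true  true  _     p⇒¬q = ⊥-elim (p⇒¬q _ _)
𝟙-∧-exclusive true  false true  _    = ≤-refl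
𝟙-∧-exclusive false true  true  _    = ≤-refl
𝟙-∧-exclusive false false true  _    = z≤n
𝟙-∧-exclusive true  false false _    = z≤n
𝟙-∧-exclusive false true  false _    = z≤n
𝟙-∧-exclusive false false false _    = z≤n

neq-sym : ∀ {n} (a b : Fin n) → neq a b ≡ neq b a
neq-sym a b with a ≟ b | b ≟ a
... | yes _   | yes _   = refl
... | no  _   | no  _   = refl
... | yes a≡b | no  b≢a = ⊥-elim (b≢a (sym a≡b))
... | no  a≢b | yes b≡a = ⊥-elim (a≢b (sym b≡a))

neq-irrefl : ∀ {n} (a : Fin n) → neq a a ≡ false
neq-irrefl a with a ≟ a
... | yes _   = refl
... | no  a≢a = ⊥-elim (a≢a refl)

disjoint-sym : ∀ {n} (e f : Edge n) → disjoint e f ≡ disjoint f e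
disjoint-sym (a , b) (c , d)
  rewrite neq-sym c a | neq-sym c b | neq-sym d a | neq-sym d b = ∧-swap-middle (neq a c) (neq a d) (neq b c) (neq b d)
  where
  ∧-swap-middle : ∀ p q r s → p ∧ q ∧ r ∧ s ≡ p ∧ r ∧ q ∧ s
  ∧-swap-middle true  true  r s = refl
  ∧-swap-middle true  false r s = sym (∧-zeroʳ r)
  ∧-swap-middle false q     r s = refl

disjoint-irrefl : ∀ {n} (e : Edge n) → disjoint e e ≡ false
disjoint-irrefl (a , b) rewrite neq-irrefl a = refl

foldr-∧≡all : ∀ (p : A → Bool) xs → foldr (λ x b → p x ∧ b) true xs ≡ all p xs
foldr-∧≡all p []       = refl
foldr-∧≡all p (x ∷ xs) = cong (p x ∧_) (foldr-∧≡all p xs)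

pairwiseDisjoint≡pairwiseᵇ : ∀ {n} (es : List (Edge n)) → pairwiseDisjoint es ≡ pairwiseᵇ disjoint es
pairwiseDisjoint≡pairwiseᵇ []       = refl
pairwiseDisjoint≡pairwiseᵇ (e ∷ es) =
  cong₂ _∧_ (foldr-∧≡all (disjoint e) es) (pairwiseDisjoint≡pairwiseᵇ es)

module _ {n} (G : Graph n) where

  degree≤maxDegree : ∀ a → degree G a ≤ maxDegree G
  degree≤maxDegree a = ≤-foldr-⊔ (degree G) (∈-allFin a)

  ordered-adj : Fin n → Fin n → Bool
  ordered-adj i j = (toℕ i <ᵇ toℕ j) ∧ adj G i j

  ∑-edges : ∀ (f : Edge n → ℕ) →
    ∑ (edges G) f ≡ ∑[ i ∈ allFin n ] ∑[ j ∈ allFin n ] (𝟙 (ordered-adj i j) * f (i , j))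
  ∑-edges f = trans (∑-concatMap f row (allFin n)) (∑-cong row-sum (allFin n))
    where
    row : Fin n → List (Edge n)
    row i = map (λ j → (i , j)) (filterᵇ (ordered-adj i) (allFin n))
    row-sum : ∀ i → ∑ (row i) f ≡ ∑[ j ∈ allFin n ] (𝟙 (ordered-adj i j) * f (i , j))
    row-sum i = trans (∑-map f (λ j → (i , j)) (filterᵇ (ordered-adj i) (allFin n)))
                      (∑-filterᵇ (ordered-adj i) (λ j → f (i , j)) (allFin n))

  incidence : Fin n → Edge n → ℕ
  incidence a (i , j) = 𝟙 ⌊ a ≟ i ⌋ + 𝟙 ⌊ a ≟ j ⌋

  -- Each edge at a is listed once, as (a , j) with a < j or as (i , a) with i < a.
  ∑-incidence≤degree : ∀ a → ∑[ e ∈ edges G ] incidence a e ≤ degree G a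
  ∑-incidence≤degree a = begin
    ∑[ e ∈ edges G ] incidence a e
      ≡⟨ ∑-edges (incidence a) ⟩
    ∑[ i ∈ allFin n ] ∑[ j ∈ allFin n ] (c i j * incidence a (i , j))
      ≡⟨ ∑-cong row (allFin n) ⟩
    ∑[ i ∈ allFin n ] (δ i * ∑[ j ∈ allFin n ] c i j + c i a)
      ≡⟨ ∑-distrib-+ (λ i → δ i * ∑[ j ∈ allFin n ] c i j) (λ i → c i a) (allFin n) ⟩
    ∑[ i ∈ allFin n ] (δ i * ∑[ j ∈ allFin n ] c i j) + ∑[ i ∈ allFin n ] c i a
      ≡⟨ cong (_+ ∑[ i ∈ allFin n ] c i a) (∑-δ a (λ i → ∑[ j ∈ allFin n ] c i j)) ⟩
    ∑[ j ∈ allFin n ] c a j + ∑[ j ∈ allFin n ] c j a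
      ≡⟨ ∑-distrib-+ (c a) (λ j → c j a) (allFin n) ⟨
    ∑[ j ∈ allFin n ] (c a j + c j a)
      ≤⟨ ∑-mono-≤ one-orientation (allFin n) ⟩
    ∑[ j ∈ allFin n ] 𝟙 (adj G a j)
      ≡⟨ length-filterᵇ≡∑𝟙 (adj G a) (allFin n) ⟨
    degree G a ∎
    where
    open ≤-Reasoning
    c : Fin n → Fin n → ℕ
    c i j = 𝟙 (ordered-adj i j)
    δ : Fin n → ℕ
    δ i = 𝟙 ⌊ a ≟ i ⌋
    row : ∀ i → ∑[ j ∈ allFin n ] (c i j * incidence a (i , j)) ≡ δ i * ∑[ j ∈ allFin n ] c i j + c i a
    row i = begin-equality
      ∑[ j ∈ allFin n ] (c i j * (δ i + δ j))
        ≡⟨ ∑-cong (λ j → *-distribˡ-+ (c i j) (δ i) (δ j)) (allFin n) ⟩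
      ∑[ j ∈ allFin n ] (c i j * δ i + c i j * δ j)
        ≡⟨ ∑-distrib-+ (λ j → c i j * δ i) (λ j → c i j * δ j) (allFin n) ⟩
      ∑[ j ∈ allFin n ] (c i j * δ i) + ∑[ j ∈ allFin n ] (c i j * δ j)
        ≡⟨ cong₂ _+_ (∑-cong (λ j → *-comm (c i j) (δ i)) (allFin n))
                     (∑-cong (λ j → *-comm (c i j) (δ j)) (allFin n)) ⟩
      ∑[ j ∈ allFin n ] (δ i * c i j) + ∑[ j ∈ allFin n ] (δ j * c i j)
        ≡⟨ cong₂ _+_ (∑-distribˡ-* (δ i) (c i) (allFin n)) (∑-δ a (c i)) ⟩
      δ i * ∑[ j ∈ allFin n ] c i j + c i a ∎
    one-orientation : ∀ j → c a j + c j a ≤ 𝟙 (adj G a j)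
    one-orientation j rewrite Graph.sym G j a =
      𝟙-∧-exclusive (toℕ a <ᵇ toℕ j) (toℕ j <ᵇ toℕ a) (adj G a j)
        (λ a<j j<a → <-asym (<ᵇ⇒< (toℕ a) (toℕ j) a<j) (<ᵇ⇒< (toℕ j) (toℕ a) j<a))

  not-disjoint≤incidence : ∀ a b e → 𝟙 (not (disjoint (a , b) e)) ≤ incidence a e + incidence b e
  not-disjoint≤incidence a b (i , j) = some≤sum ⌊ a ≟ i ⌋ ⌊ a ≟ j ⌋ ⌊ b ≟ i ⌋ ⌊ b ≟ j ⌋
    where
    some≤sum : ∀ p q r s → 𝟙 (not (not p ∧ not q ∧ not r ∧ not s)) ≤ (𝟙 p + 𝟙 q) + (𝟙 r + 𝟙 s)
    some≤sum true  q     r     s     = s≤s z≤n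
    some≤sum false true  r     s     = s≤s z≤n
    some≤sum false false true  s     = s≤s z≤n
    some≤sum false false false true  = s≤s z≤n
    some≤sum false false false false = z≤n

  conflicts≤2*maxDegree : ∀ x → Cliques.conflicts disjoint x (edges G) ≤ 2 * maxDegree G
  conflicts≤2*maxDegree (a , b) = begin
    Cliques.conflicts disjoint (a , b) (edges G)
      ≡⟨ length-filterᵇ≡∑𝟙 (not ∘ disjoint (a , b)) (edges G) ⟩
    ∑[ e ∈ edges G ] 𝟙 (not (disjoint (a , b) e))
      ≤⟨ ∑-mono-≤ (not-disjoint≤incidence a b) (edges G) ⟩
    ∑[ e ∈ edges G ] (incidence a e + incidence b e)
      ≡⟨ ∑-distrib-+ (incidence a) (incidence b) (edges G) ⟩
    ∑[ e ∈ edges G ] incidence a e + ∑[ e ∈ edges G ] incidence b e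
      ≤⟨ +-mono-≤ (≤-trans (∑-incidence≤degree a) (degree≤maxDegree a))
                  (≤-trans (∑-incidence≤degree b) (degree≤maxDegree b)) ⟩
    maxDegree G + maxDegree G
      ≡⟨ cong (maxDegree G +_) (+-identityʳ (maxDegree G)) ⟨
    2 * maxDegree G ∎
    where open ≤-Reasoning

  numCliques≡numMatchings : ∀ t → Cliques.numCliques disjoint t (edges G) ≡ numMatchings t G
  numCliques≡numMatchings t =
    cong length (filterᵇ-cong (λ es → sym (pairwiseDisjoint≡pairwiseᵇ es)) (choose t (edges G)))

  numMatchings-lowerBound : ∀ t → (numEdges G ∸ t * (2 * maxDegree G)) ^ t ≤ t ! * numMatchings t G
  numMatchings-lowerBound t =
    subst (λ N → (numEdges G ∸ t * (2 * maxDegree G)) ^ t ≤ t ! * N) (numCliques≡numMatchings t)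
      (Cliques.numCliques-lowerBound disjoint disjoint-sym disjoint-irrefl
        (2 * maxDegree G) t (edges G) conflicts≤2*maxDegree)

lemma5p3 : ∀ {n} (G : Graph n) (t : ℕ) → 1 ≤ t →
    (4 * maxDegree G * t ≤ numEdges G →
      numEdges G ^ t ≤ (2 ^ t * t !) * numMatchings t G)
    × (4 * maxDegree G * (t * t) ≤ numEdges G →
      numEdges G ^ t ≤ (2 * t !) * numMatchings t G)
lemma5p3 G t@(suc t′) _ = doubling , mean-value
  where
  open ≤-Reasoning
  d E N a : ℕ
  d = maxDegree G
  E = numEdges G
  N = numMatchings t G
  a = t * (2 * d)
  greedy : (E ∸ a) ^ t ≤ t ! * N
  greedy = numMatchings-lowerBound G t
  doubling : 4 * d * t ≤ E → E ^ t ≤ 2 ^ t * t ! * N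
  doubling 4dt≤E = begin
    E ^ t                ≤⟨ m^t≤2^t*[m∸a]^t E a t (subst (_≤ E) (4dt≡2a d t) 4dt≤E) ⟩
    2 ^ t * (E ∸ a) ^ t  ≤⟨ *-monoʳ-≤ (2 ^ t) greedy ⟩
    2 ^ t * (t ! * N)    ≡⟨ *-assoc (2 ^ t) (t !) N ⟨
    2 ^ t * t ! * N      ∎
    where
    4dt≡2a : ∀ d t → 4 * d * t ≡ 2 * (t * (2 * d))
    4dt≡2a = solve-∀
  mean-value : 4 * d * (t * t) ≤ E → E ^ t ≤ 2 * t ! * N
  mean-value 4dt²≤E = begin
    E ^ t                ≤⟨ m^[1+t]≤2*[m∸a]^[1+t] E a t′ (subst (_≤ E) (4dt²≡2ta d t) 4dt²≤E) ⟩
    2 * (E ∸ a) ^ t      ≤⟨ *-monoʳ-≤ 2 greedy ⟩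
    2 * (t ! * N)        ≡⟨ *-assoc 2 (t !) N ⟨
    2 * t ! * N          ∎
    where
    4dt²≡2ta : ∀ d t → 4 * d * (t * t) ≡ 2 * (t * (t * (2 * d)))
    4dt²≡2ta = solve-∀
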